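{- Let $G$ be a group, $X$ a bounded $G$-lattice and $n\in\mathbb N$. If $\partial^n p_X(\mathbf 1)=0$, then for each subset $A\subset X$ with $|A|\le n$ and $\bigvee A=\mathbf 1$ we have $\sum_{a\in A}p_X(a)\ge1$ and $\min_{a\in A}\operatorname{lar}(\Delta(a))=\frac{1}{\max_{a\in A}p_X(a)}\le n$.
   Context: A lattice is a set $X$ with commutative, associative, idempotent operations $\vee,\wedge$ satisfying the absorption laws, ordered by $x\le y$ iff $x\wedge y=x$; bounded means there are least and greatest elements $\mathbf 0\ne\mathbf 1$. A $G$-lattice is a lattice with an action of $G$ by lattice automorphisms. $\Delta(a)=\{g\in G:ga\wedge a\ne\mathbf 0\}$; for nonempty $D\subset G$, $\operatorname{lar}(D)=\min\{|F|:F\subset G,\ G=FD\}$, and $\operatorname{lar}(\emptyset)$ is the smallest infinite cardinal $>|G|$. $p_X(a)=1/\operatorname{lar}(\Delta(a))$ if $0<\operatorname{lar}(\Delta(a))<\omega$, else $0$. For $x\in X$, $x/n=\{A\subset X:|A|\le n,\ \bigvee A=x\}$ and $\partial^n\mu(x)=\sup_{A\in x/n}(\mu(x)-\sum_{a\in A}\mu(a))$. -}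

module Defs where

open import Level using (0ℓ)
open import Data.Nat as ℕ using (ℕ; suc; _≤_)
open import Data.Fin using (Fin)
open import Data.Product using (Σ; Σ-syntax; ∃; ∃-syntax; _×_)
open import Data.Sum using (_⊎_)
open import Data.List using (List; []; _∷_; length; foldr)
open import Data.List.Relation.Unary.Unique.Propositional using (Unique)
open import Data.Integer using (+_)
open import Data.Rational as ℚ using (ℚ; 0ℚ; 1ℚ; _-_; _/_)
open import Relation.Nullary using (¬_)
open import Relation.Binary.PropositionalEquality using (_≡_; _≢_)
open import Algebra.Core using (Op₁; Op₂)
import Algebra.Structures as AS
import Algebra.Lattice.Structures as LS

record GroupOn (G : Set) : Set where
  field
    _∙_ : Op₂ G
    ε   : G
    _⁻¹ : Op₁ G
    isGroup : AS.IsGroup _≡_ _∙_ ε _⁻¹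

record BoundedGLattice {G : Set} (grp : GroupOn G) (X : Set) : Set where
  open GroupOn grp
  field
    _∨_ : Op₂ X
    _∧_ : Op₂ X
    isLattice : LS.IsLattice _≡_ _∨_ _∧_
    𝟘 𝟙 : X
    𝟘-least    : ∀ x → 𝟘 ∧ x ≡ 𝟘
    𝟙-greatest : ∀ x → x ∧ 𝟙 ≡ x
    𝟘≢𝟙 : 𝟘 ≢ 𝟙
    act : G → X → X
    act-ε : ∀ x → act ε x ≡ x
    act-∙ : ∀ g h x → act (g ∙ h) x ≡ act g (act h x)
    act-∨ : ∀ g x y → act g (x ∨ y) ≡ act g x ∨ act g y
    act-∧ : ∀ g x y → act g (x ∧ y) ≡ act g x ∧ act g y

module _ {G X : Set} {grp : GroupOn G} (L : BoundedGLattice grp X) where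
  open GroupOn grp
  open BoundedGLattice L

  Δ : X → G → Set
  Δ a g = act g a ∧ a ≢ 𝟘

  -- G = F D for some F ⊂ G with |F| ≤ m (F given as an m-indexed family).
  Covers : (G → Set) → ℕ → Set
  Covers D m = Σ[ F ∈ (Fin m → G) ] (∀ g → ∃[ i ] ∃[ d ] (D d × g ≡ F i ∙ d))

  LarIs : (G → Set) → ℕ → Set
  LarIs D k = Covers D k × (∀ m → Covers D m → k ≤ m)

  -- Specification of p_X : X → ℚ:
  -- p_X(a) = 1/lar(Δ a) if 0 < lar(Δ a) < ω, and 0 otherwise.
  IsPX : (X → ℚ) → Set
  IsPX p = ∀ a →
      (Σ[ k ∈ ℕ ] (LarIs (Δ a) (suc k) × p a ≡ (+ 1) / suc k))
    ⊎ ((¬ (Σ[ k ∈ ℕ ] LarIs (Δ a) (suc k))) × p a ≡ 0ℚ)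

  ⋁ : List X → X
  ⋁ = foldr _∨_ 𝟘

  -- A ∈ x/n : A a finite subset (duplicate-free list) with |A| ≤ n and ⋁ A = x
  _∈_/_ : List X → X → ℕ → Set
  A ∈ x / n = Unique A × length A ≤ n × ⋁ A ≡ x

  Σℚ : (X → ℚ) → List X → ℚ
  Σℚ μ = foldr (λ a s → μ a ℚ.+ s) 0ℚ

  defect : (X → ℚ) → X → List X → ℚ
  defect μ x A = μ x - Σℚ μ A

  -- ∂ⁿ μ (x) = 0, i.e. sup_{A ∈ x/n} (μ x − Σ_{a∈A} μ a) = 0:
  -- 0 is an upper bound, and no rational q < 0 is an upper bound.
  ∂-zero : ℕ → (X → ℚ) → X → Set
  ∂-zero n μ x =
      (∀ A → A ∈ x / n → defect μ x A ℚ.≤ 0ℚ)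
    × (∀ q → q ℚ.< 0ℚ → Σ[ A ∈ List X ] (A ∈ x / n × q ℚ.< defect μ x A))

-- Since Δ(𝟙) = G, lar(Δ 𝟙) = 1 and p_X(𝟙) = 1; the upper-bound
-- half of ∂ⁿ p_X(𝟙) = 0 then reads 1 − Σ_A p_X ≤ 0, i.e. Σ_A p_X ≥ 1.
-- Every value of p_X is 0 or a unit fraction 1/(k+1), and an element whose
-- Δ admits a finite cover always gets a unit fraction (a finite cover forces
-- a least one).  Let a maximise p_X on A.  All |A| summands are at most
-- p_X(a), so 1 ≤ |A|·p_X(a): this rules out p_X(a) = 0, and for
-- p_X(a) = 1/(k+1) it gives k+1 ≤ |A| ≤ n.  Maximality of p_X(a) among unit
-- fractions is minimality of lar(Δ a) among the lar(Δ a′).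
module Submission where

open import Defs
open import Data.Nat using (ℕ; _≤_)
open import Data.Product using (Σ-syntax; ∃-syntax; _×_)
open import Data.List using (List)
open import Data.List.Membership.Propositional using (_∈_)
open import Data.Integer using (+_)
open import Data.Rational using (ℚ; 1ℚ; _/_) renaming (_≤_ to _≤ℚ_; _*_ to _*ℚ_)
open import Relation.Binary.PropositionalEquality using (_≡_)

open import Data.Nat as ℕ using (zero; suc; z≤n; s≤s; _<_)
import Data.Nat.Properties as ℕP
open import Data.Nat.Induction using (<-rec)
open import Data.Product using (_,_)
open import Data.Sum using (inj₁; inj₂)
open import Data.Empty using (⊥-elim)
open import Data.Fin using (Fin)
open import Data.List using ([]; _∷_; length)
open import Data.List.Relation.Unary.Any using (here; there)
import Data.Integer as ℤ
import Data.Integer.Properties as ℤP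
open import Data.Integer.Tactic.RingSolver using (solve-∀)
import Data.Rational as ℚ
import Data.Rational.Properties as ℚP
open import Data.Rational.Unnormalised as ℚᵘ using (mkℚᵘ; *≡*; *≤*)
  renaming (_≃_ to _≃ᵘ_; _≤_ to _≤ᵘ_)
import Data.Rational.Unnormalised.Properties as ℚᵘP
open import Relation.Binary.PropositionalEquality
  using (refl; sym; trans; cong; cong₂; subst; subst₂; module ≡-Reasoning)
open import Relation.Nullary using (¬_)
import Algebra.Structures as AS
import Algebra.Lattice.Structures as LS

-- Arithmetic of fractions.  The fraction j/(k+1) is written mkℚᵘ (+ j) k;
-- the normalised rationals (+ j) / suc k of the statement are compared with
-- it through toℚᵘ.

p-q+q≡p : ∀ (p q : ℚ) → (p ℚ.- q) ℚ.+ q ≡ p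
p-q+q≡p p q = begin
    (p ℚ.- q) ℚ.+ q     ≡⟨ ℚP.+-assoc p (ℚ.- q) q ⟩
    p ℚ.+ (ℚ.- q ℚ.+ q) ≡⟨ cong (p ℚ.+_) (ℚP.+-inverseˡ q) ⟩
    p ℚ.+ ℚ.0ℚ          ≡⟨ ℚP.+-identityʳ p ⟩
    p                   ∎
  where open ≡-Reasoning

p-q≤0⇒p≤q : ∀ {p q : ℚ} → p ℚ.- q ≤ℚ ℚ.0ℚ → p ≤ℚ q
p-q≤0⇒p≤q {p} {q} p-q≤0 = begin
    p               ≡⟨ sym (p-q+q≡p p q) ⟩
    (p ℚ.- q) ℚ.+ q ≤⟨ ℚP.+-monoˡ-≤ q p-q≤0 ⟩
    ℚ.0ℚ ℚ.+ q      ≡⟨ ℚP.+-identityˡ q ⟩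
    q               ∎
  where open ℚP.≤-Reasoning

toℚᵘ-/ : ∀ j k → ℚ.toℚᵘ ((+ j) / suc k) ≃ᵘ mkℚᵘ (+ j) k
toℚᵘ-/ j k = ℚP.toℚᵘ-fromℚᵘ (mkℚᵘ (+ j) k)

+-commonDenominator : ∀ i j k →
  mkℚᵘ (+ i) k ℚᵘ.+ mkℚᵘ (+ j) k ≃ᵘ mkℚᵘ (+ (i ℕ.+ j)) k
+-commonDenominator i j k = *≡* (begin
    (+ i ℤ.* + d ℤ.+ + j ℤ.* + d) ℤ.* + d ≡⟨ factor (+ i) (+ j) (+ d) ⟩
    (+ i ℤ.+ + j) ℤ.* (+ d ℤ.* + d)       ≡⟨ cong₂ ℤ._*_ (sym (ℤP.pos-+ i j)) (sym (ℤP.pos-* d d)) ⟩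
    + (i ℕ.+ j) ℤ.* + (d ℕ.* d)           ∎)
  where
  open ≡-Reasoning
  d = suc k
  factor : ∀ (x y z : ℤ.ℤ) → (x ℤ.* z ℤ.+ y ℤ.* z) ℤ.* z ≡ (x ℤ.+ y) ℤ.* (z ℤ.* z)
  factor = solve-∀

1≤c/[1+k]⇒1+k≤c : ∀ c k → ℚᵘ.1ℚᵘ ≤ᵘ mkℚᵘ (+ c) k → suc k ≤ c
1≤c/[1+k]⇒1+k≤c c k (*≤* 1*[1+k]≤c*1) =
  ℤP.drop‿+≤+ (subst₂ ℤ._≤_ (ℤP.*-identityˡ (+ suc k)) (ℤP.*-identityʳ (+ c)) 1*[1+k]≤c*1)

unitFraction-≤⇒≥ : ∀ k k′ → (+ 1) / suc k′ ≤ℚ (+ 1) / suc k → k ≤ k′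
unitFraction-≤⇒≥ k k′ le with ℚᵘP.≤-respˡ-≃ (toℚᵘ-/ 1 k′) (ℚᵘP.≤-respʳ-≃ (toℚᵘ-/ 1 k) (ℚP.toℚᵘ-mono-≤ le))
... | *≤* 1*[1+k]≤1*[1+k′] = ℕ.s≤s⁻¹ (ℤP.drop‿+≤+
  (subst₂ ℤ._≤_ (ℤP.*-identityˡ (+ suc k)) (ℤP.*-identityˡ (+ suc k′)) 1*[1+k]≤1*[1+k′]))

unitFraction*denominator : ∀ k → ((+ 1) / suc k) *ℚ ((+ suc k) / 1) ≡ 1ℚ
unitFraction*denominator k = ℚP.toℚᵘ-injective (begin
    ℚ.toℚᵘ (((+ 1) / suc k) *ℚ ((+ suc k) / 1))        ≈⟨ ℚP.toℚᵘ-homo-* ((+ 1) / suc k) ((+ suc k) / 1) ⟩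
    ℚ.toℚᵘ ((+ 1) / suc k) ℚᵘ.* ℚ.toℚᵘ ((+ suc k) / 1) ≈⟨ ℚᵘP.*-cong (toℚᵘ-/ 1 k) (toℚᵘ-/ (suc k) 0) ⟩
    mkℚᵘ (+ 1) k ℚᵘ.* mkℚᵘ (+ suc k) 0                  ≈⟨ *≡* numerator≡denominator ⟩
    ℚᵘ.1ℚᵘ                                              ∎)
  where
  open import Relation.Binary.Reasoning.Setoid ℚᵘP.≃-setoid
  numerator≡denominator : (+ 1 ℤ.* + suc k) ℤ.* + 1 ≡ + 1 ℤ.* + (suc k ℕ.* 1)
  numerator≡denominator =
    trans (ℤP.*-identityʳ _) (cong (λ m → + 1 ℤ.* + m) (sym (ℕP.*-identityʳ (suc k))))

-- Constructive least-element principle: a predicate on ℕ without a least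
-- witness has no witness at all.  It turns "Δ a has no finite lar" into
-- "Δ a has no finite cover".
noLeast⇒empty : (P : ℕ → Set) → ¬ (∃[ k ] (P k × ∀ m → P m → k ≤ m)) → ∀ m → ¬ P m
noLeast⇒empty P noLeast = <-rec (λ m → ¬ P m) step
  where
  step : ∀ m → (∀ {m′} → m′ < m → ¬ P m′) → ¬ P m
  step m below Pm = noLeast (m , Pm , λ m′ Pm′ → ℕP.≮⇒≥ (λ m′<m → below m′<m Pm′))

argmax : ∀ {A : Set} (f : A → ℚ) (x : A) (xs : List A) →
  Σ[ a ∈ A ] (a ∈ x ∷ xs × (∀ a′ → a′ ∈ x ∷ xs → f a′ ≤ℚ f a))
argmax f x [] = x , here refl , λ { _ (here refl) → ℚP.≤-refl }
argmax f x (y ∷ ys) with argmax f y ys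
... | b , b∈ , b-max with ℚP.≤-total (f x) (f b)
...   | inj₁ fx≤fb = b , there b∈ , λ { _ (here refl) → fx≤fb ; a′ (there a′∈) → b-max a′ a′∈ }
...   | inj₂ fb≤fx = x , here refl , λ { _ (here refl) → ℚP.≤-refl
                                       ; a′ (there a′∈) → ℚP.≤-trans (b-max a′ a′∈) fb≤fx }

module GLatticeFacts {G X : Set} (grp : GroupOn G) (L : BoundedGLattice grp X) where
  open GroupOn grp
  open BoundedGLattice L
  open AS.IsGroup isGroup using (inverseˡ; inverseʳ; identityˡ)
  open LS.IsLattice isLattice using (∧-comm)

  Σℚ-≤ : ∀ (μ : X → ℚ) j k A → (∀ x → x ∈ A → ℚ.toℚᵘ (μ x) ≤ᵘ mkℚᵘ (+ j) k) →
    ℚ.toℚᵘ (Σℚ L μ A) ≤ᵘ mkℚᵘ (+ (length A ℕ.* j)) k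
  Σℚ-≤ μ j k [] _ = *≤* (ℤ.+≤+ z≤n)
  Σℚ-≤ μ j k (x ∷ xs) bound = begin
    ℚ.toℚᵘ (μ x ℚ.+ Σℚ L μ xs)                  ≃⟨ ℚP.toℚᵘ-homo-+ (μ x) (Σℚ L μ xs) ⟩
    ℚ.toℚᵘ (μ x) ℚᵘ.+ ℚ.toℚᵘ (Σℚ L μ xs)        ≤⟨ ℚᵘP.+-mono-≤ (bound x (here refl))
                                                     (Σℚ-≤ μ j k xs (λ y y∈ → bound y (there y∈))) ⟩
    mkℚᵘ (+ j) k ℚᵘ.+ mkℚᵘ (+ (length xs ℕ.* j)) k ≃⟨ +-commonDenominator j (length xs ℕ.* j) k ⟩
    mkℚᵘ (+ (j ℕ.+ length xs ℕ.* j)) k           ∎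
    where open ℚᵘP.≤-Reasoning

  mass≥1⇒count : ∀ (μ : X → ℚ) j k A → 1ℚ ≤ℚ Σℚ L μ A →
    (∀ x → x ∈ A → ℚ.toℚᵘ (μ x) ≤ᵘ mkℚᵘ (+ j) k) → suc k ≤ length A ℕ.* j
  mass≥1⇒count μ j k A 1≤Σ bound =
    1≤c/[1+k]⇒1+k≤c _ k (ℚᵘP.≤-trans (ℚP.toℚᵘ-mono-≤ 1≤Σ) (Σℚ-≤ μ j k A bound))

  act-cancel : ∀ g h x → h ∙ g ≡ ε → act h (act g x) ≡ x
  act-cancel g h x hg≡ε = begin
    act h (act g x) ≡⟨ sym (act-∙ h g x) ⟩
    act (h ∙ g) x   ≡⟨ cong (λ k → act k x) hg≡ε ⟩
    act ε x         ≡⟨ act-ε x ⟩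
    x               ∎
    where open ≡-Reasoning

  -- Lattice automorphisms fix the bottom element: g𝟘 = g(𝟘 ∧ g⁻¹𝟘) = g𝟘 ∧ 𝟘.
  act-𝟘 : ∀ g → act g 𝟘 ≡ 𝟘
  act-𝟘 g = begin
    act g 𝟘                             ≡⟨ cong (act g) (sym (𝟘-least (act (g ⁻¹) 𝟘))) ⟩
    act g (𝟘 ∧ act (g ⁻¹) 𝟘)            ≡⟨ act-∧ g 𝟘 (act (g ⁻¹) 𝟘) ⟩
    act g 𝟘 ∧ act g (act (g ⁻¹) 𝟘)      ≡⟨ cong (act g 𝟘 ∧_) (act-cancel (g ⁻¹) g 𝟘 (inverseʳ g)) ⟩
    act g 𝟘 ∧ 𝟘                         ≡⟨ ∧-comm (act g 𝟘) 𝟘 ⟩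
    𝟘 ∧ act g 𝟘                         ≡⟨ 𝟘-least (act g 𝟘) ⟩
    𝟘                                   ∎
    where open ≡-Reasoning

  -- Δ(𝟙) = G: if g𝟙 ∧ 𝟙 = 𝟘 then g𝟙 = 𝟘, hence 𝟙 = g⁻¹(g𝟙) = 𝟘.
  Δ𝟙-total : ∀ g → Δ L 𝟙 g
  Δ𝟙-total g g𝟙∧𝟙≡𝟘 = 𝟘≢𝟙 (sym (begin
    𝟙                           ≡⟨ sym (act-cancel g (g ⁻¹) 𝟙 (inverseˡ g)) ⟩
    act (g ⁻¹) (act g 𝟙)        ≡⟨ cong (act (g ⁻¹)) (sym (𝟙-greatest (act g 𝟙))) ⟩
    act (g ⁻¹) (act g 𝟙 ∧ 𝟙)    ≡⟨ cong (act (g ⁻¹)) g𝟙∧𝟙≡𝟘 ⟩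
    act (g ⁻¹) 𝟘                ≡⟨ act-𝟘 (g ⁻¹) ⟩
    𝟘                           ∎))
    where open ≡-Reasoning

  ¬Covers-0 : ∀ D → ¬ Covers L D 0
  ¬Covers-0 D (F , covers) with covers ε
  ... | () , _

  -- lar(Δ 𝟙) = 1: the single translate ε Δ(𝟙) is already G.
  lar-Δ𝟙 : LarIs L (Δ L 𝟙) 1
  lar-Δ𝟙 = ((λ _ → ε) , λ g → Fin.zero , g , Δ𝟙-total g , sym (identityˡ g)) , atLeastOne
    where
    atLeastOne : ∀ m → Covers L (Δ L 𝟙) m → 1 ≤ m
    atLeastOne zero    c = ⊥-elim (¬Covers-0 _ c)
    atLeastOne (suc m) _ = s≤s z≤n

  LarIs-unique : ∀ {D k k′} → LarIs L D k → LarIs L D k′ → k ≡ k′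
  LarIs-unique (c , minimal) (c′ , minimal′) = ℕP.≤-antisym (minimal _ c′) (minimal′ _ c)

  noLar⇒noCover : ∀ D → ¬ (Σ[ k ∈ ℕ ] LarIs L D (suc k)) → ∀ m → ¬ Covers L D m
  noLar⇒noCover D noLar = noLeast⇒empty (Covers L D) least⇒lar
    where
    least⇒lar : ¬ (∃[ k ] (Covers L D k × ∀ m → Covers L D m → k ≤ m))
    least⇒lar (zero  , c , _)       = ¬Covers-0 D c
    least⇒lar (suc k , c , minimal) = noLar (k , c , minimal)

  module ValuesOf-p (p : X → ℚ) (isPX : IsPX L p) where

    p𝟙≡1 : p 𝟙 ≡ 1ℚ
    p𝟙≡1 with isPX 𝟙
    ... | inj₁ (k , lar , p𝟙≡1/[1+k]) with LarIs-unique lar lar-Δ𝟙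
    ...   | refl = p𝟙≡1/[1+k]
    p𝟙≡1 | inj₂ (noLar , _) = ⊥-elim (noLar (0 , lar-Δ𝟙))

    p≤1/[1+k]⇒cover≥1+k : ∀ a′ k m → p a′ ≤ℚ (+ 1) / suc k → Covers L (Δ L a′) m → suc k ≤ m
    p≤1/[1+k]⇒cover≥1+k a′ k m p≤ c with isPX a′
    ... | inj₁ (k′ , (_ , minimal) , pa′≡1/[1+k′]) =
      ℕP.≤-trans (s≤s (unitFraction-≤⇒≥ k k′ (subst (_≤ℚ (+ 1) / suc k) pa′≡1/[1+k′] p≤)))
                 (minimal m c)
    ... | inj₂ (noLar , _) = ⊥-elim (noLar⇒noCover (Δ L a′) noLar m c)

    mass≥1 : ∀ n A → ∂-zero L n p 𝟙 → _∈_/_ L A 𝟙 n → 1ℚ ≤ℚ Σℚ L p A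
    mass≥1 n A (defect≤0 , _) A∈ =
      subst (_≤ℚ Σℚ L p A) p𝟙≡1 (p-q≤0⇒p≤q (defect≤0 A A∈))

    maxValue-unitFraction : ∀ A a → 1ℚ ≤ℚ Σℚ L p A → (∀ y → y ∈ A → p y ≤ℚ p a) →
      Σ[ k ∈ ℕ ] (LarIs L (Δ L a) (suc k) × p a ≡ (+ 1) / suc k)
    maxValue-unitFraction A a 1≤Σ p≤pa with isPX a
    ... | inj₁ unit         = unit
    ... | inj₂ (_ , pa≡0) with mass≥1⇒count p 0 0 A 1≤Σ p≤0
      where
      p≤0 : ∀ y → y ∈ A → ℚ.toℚᵘ (p y) ≤ᵘ mkℚᵘ (+ 0) 0
      p≤0 y y∈ = ℚP.toℚᵘ-mono-≤ (subst (p y ≤ℚ_) pa≡0 (p≤pa y y∈))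
    ...   | 1≤|A|*0 with subst (1 ≤_) (ℕP.*-zeroʳ (length A)) 1≤|A|*0
    ...     | ()

    maximiser : ∀ n A → 1ℚ ≤ℚ Σℚ L p A → _∈_/_ L A 𝟙 n →
      Σ[ a ∈ X ] Σ[ k ∈ ℕ ] (a ∈ A × LarIs L (Δ L a) k × k ≤ n
          × (∀ a′ → a′ ∈ A → ∀ m → Covers L (Δ L a′) m → k ≤ m)
          × (∀ a′ → a′ ∈ A → p a′ ≤ℚ p a)
          × p a *ℚ ((+ k) / 1) ≡ 1ℚ)
    maximiser n []       _   (_ , _ , ⋁[]≡𝟙) = ⊥-elim (𝟘≢𝟙 ⋁[]≡𝟙)
    maximiser n (x ∷ xs) 1≤Σ (_ , |A|≤n , _) with argmax p x xs
    ... | a , a∈ , p≤pa with maxValue-unitFraction (x ∷ xs) a 1≤Σ p≤pa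
    ...   | k , lar , pa≡1/[1+k] = a , suc k , a∈ , lar , 1+k≤n , least , p≤pa , pa*[1+k]≡1
      where
      p≤1/[1+k] : ∀ y → y ∈ x ∷ xs → p y ≤ℚ (+ 1) / suc k
      p≤1/[1+k] y y∈ = subst (p y ≤ℚ_) pa≡1/[1+k] (p≤pa y y∈)
      1+k≤|A| : suc k ≤ length (x ∷ xs)
      1+k≤|A| = subst (suc k ≤_) (ℕP.*-identityʳ (length (x ∷ xs)))
        (mass≥1⇒count p 1 k (x ∷ xs) 1≤Σ
          (λ y y∈ → ℚᵘP.≤-respʳ-≃ (toℚᵘ-/ 1 k) (ℚP.toℚᵘ-mono-≤ (p≤1/[1+k] y y∈))))
      1+k≤n : suc k ≤ n
      1+k≤n = ℕP.≤-trans 1+k≤|A| |A|≤n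
      least : ∀ a′ → a′ ∈ x ∷ xs → ∀ m → Covers L (Δ L a′) m → suc k ≤ m
      least a′ a′∈ m = p≤1/[1+k]⇒cover≥1+k a′ k m (p≤1/[1+k] a′ a′∈)
      pa*[1+k]≡1 : p a *ℚ ((+ suc k) / 1) ≡ 1ℚ
      pa*[1+k]≡1 = subst (λ q → q *ℚ ((+ suc k) / 1) ≡ 1ℚ) (sym pa≡1/[1+k]) (unitFraction*denominator k)

proposition1p5 : {G X : Set} (grp : GroupOn G) (L : BoundedGLattice grp X) (n : ℕ)
    (p : X → ℚ) → IsPX L p →
    ∂-zero L n p (BoundedGLattice.𝟙 L) →
    ∀ (A : List X) → _∈_/_ L A (BoundedGLattice.𝟙 L) n →
    (1ℚ ≤ℚ Σℚ L p A)
    × (Σ[ a ∈ X ] Σ[ k ∈ ℕ ] (a ∈ A × LarIs L (Δ L a) k × k ≤ n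
    × (∀ a′ → a′ ∈ A → ∀ m → Covers L (Δ L a′) m → k ≤ m)
    × (∀ a′ → a′ ∈ A → p a′ ≤ℚ p a)
    × p a *ℚ ((+ k) / 1) ≡ 1ℚ))
proposition1p5 grp L n p isPX ∂ⁿp𝟙≡0 A A∈𝟙/n = 1≤Σ , maximiser n A 1≤Σ A∈𝟙/n
  where
  open GLatticeFacts.ValuesOf-p grp L p isPX
  1≤Σ : 1ℚ ≤ℚ Σℚ L p A
  1≤Σ = mass≥1 n A ∂ⁿp𝟙≡0 A∈𝟙/n
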